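{- For every finite multiset $\Gamma$ of formulae and every formula $\varphi$ of intuitionistic linear logic, $\Gamma\vdash\varphi$ holds if and only if $\Gamma\vdash^{*}\varphi$ holds.
   Context: Formulae: $\varphi ::= p\mid\top\mid 0\mid 1\mid\varphi\multimap\varphi\mid\varphi\otimes\varphi\mid\varphi\mathbin{\&}\varphi\mid\varphi\oplus\varphi\mid\,!\varphi$ with $p$ ranging over propositional atoms. Multisets are finite, $\uplus$ is multiset union. $\Gamma\vdash\varphi$ is the smallest relation closed under: (Ax) $\varphi\vdash\varphi$; ($\multimap$I) from $\Gamma\uplus\{\varphi\}\vdash\psi$ infer $\Gamma\vdash\varphi\multimap\psi$; ($\multimap$E) from $\Gamma\vdash\varphi\multimap\psi$, $\Delta\vdash\varphi$ infer $\Gamma\uplus\Delta\vdash\psi$; ($\otimes$I) from $\Gamma\vdash\varphi$, $\Delta\vdash\psi$ infer $\Gamma\uplus\Delta\vdash\varphi\otimes\psi$; ($\otimes$E) from $\Gamma\vdash\varphi\otimes\psi$, $\Delta\uplus\{\varphi,\psi\}\vdash\chi$ infer $\Gamma\uplus\Delta\vdash\chi$; ($1$I) $\vdash1$; ($1$E) from $\Gamma\vdash1$, $\Delta\vdash\varphi$ infer $\Gamma\uplus\Delta\vdash\varphi$; ($\mathbin{\&}$I) from $\Gamma\vdash\varphi$, $\Gamma\vdash\psi$ infer $\Gamma\vdash\varphi\mathbin{\&}\psi$; ($\mathbin{\&}$E) from $\Gamma\vdash\varphi\mathbin{\&}\psi$ infer $\Gamma\vdash\varphi$ and $\Gamma\vdash\psi$;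 ($\oplus$I) from $\Gamma\vdash\varphi$ (resp. $\Gamma\vdash\psi$) infer $\Gamma\vdash\varphi\oplus\psi$; ($\oplus$E) from $\Gamma\vdash\varphi\oplus\psi$, $\Delta\uplus\{\varphi\}\vdash\chi$, $\Delta\uplus\{\psi\}\vdash\chi$ infer $\Gamma\uplus\Delta\vdash\chi$; ($\top$I, $n\ge0$) from $\Gamma_i\vdash\varphi_i$ ($i\le n$) infer $\Gamma_1\uplus\dots\uplus\Gamma_n\vdash\top$; ($0$E, $n\ge0$) from $\Gamma_i\vdash\varphi_i$ ($i\le n$) and $\Delta\vdash0$ infer $\Gamma_1\uplus\dots\uplus\Gamma_n\uplus\Delta\vdash\chi$; (Prom$_n$, $n\ge0$) from $\Gamma_i\vdash\,!\psi_i$ ($i\le n$) and $\{!\psi_1,\dots,!\psi_n\}\vdash\varphi$ infer $\Gamma_1\uplus\dots\uplus\Gamma_n\vdash\,!\varphi$; (Der) from $\Gamma\vdash\,!\varphi$, $\Delta\uplus\{\varphi\}\vdash\psi$ infer $\Gamma\uplus\Delta\vdash\psi$; (Wk) from $\Gamma\vdash\,!\varphi$, $\Delta\vdash\psi$ infer $\Gamma\uplus\Delta\vdash\psi$; (Ctr) from $\Gamma\vdash\,!\varphi$, $\Delta\uplus\{!\varphi,!\varphi\}\vdash\psi$ infer $\Gamma\uplus\Delta\vdash\psi$. Inference schemas: a box is a multiset of sequents $\Psi\Rightarrow\psi$; an inference schema is a triple $\langle\mathbf{A},\mathbf{S},\varphi\rangle$ with $\mathbf{A}$ a multiset of boxes,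 $\mathbf{S}$ a multiset of sequents, $\varphi$ a formula, where formula letters are schematic (instantiable by any formulae). The set $\mathfrak{N}$ consists of: $\langle[\{\varphi\Rightarrow\psi\}],\varnothing,\varphi\multimap\psi\rangle$; $\langle[\{\Rightarrow\varphi\multimap\psi\},\{\Rightarrow\varphi\}],\varnothing,\psi\rangle$; $\langle[\{\Rightarrow\varphi\},\{\Rightarrow\psi\}],\varnothing,\varphi\otimes\psi\rangle$; $\langle[\{\Rightarrow\varphi\otimes\psi\},\{\varphi,\psi\Rightarrow\chi\}],\varnothing,\chi\rangle$; $\langle\varnothing,\varnothing,1\rangle$; $\langle[\{\Rightarrow1\},\{\Rightarrow\chi\}],\varnothing,\chi\rangle$; $\langle[\{\Rightarrow\varphi,\ \Rightarrow\psi\}],\varnothing,\varphi\mathbin{\&}\psi\rangle$ (one box containing both sequents); $\langle[\{\Rightarrow\varphi\mathbin{\&}\psi\}],\varnothing,\varphi\rangle$; $\langle[\{\Rightarrow\varphi\mathbin{\&}\psi\}],\varnothing,\psi\rangle$; $\langle[\{\Rightarrow\varphi\}],\varnothing,\varphi\oplus\psi\rangle$; $\langle[\{\Rightarrow\psi\}],\varnothing,\varphi\oplus\psi\rangle$; $\langle[\{\Rightarrow\varphi\oplus\psi\},\{\varphi\Rightarrow\chi,\ \psi\Rightarrow\chi\}],\varnothing,\chi\rangle$; for each $n\ge0$, $\langle[\{\Rightarrow\varphi_1\},\dots,\{\Rightarrow\varphi_n\}],\varnothing,\top\rangle$ and $\langle[\{\Rightarrow\varphi_1\},\dots,\{\Rightarrow\varphi_n\},\{\Rightarrow0\}],\varnothing,\chi\rangle$;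 $\langle\varnothing,[\Rightarrow\varphi],\,!\varphi\rangle$; $\langle[\{\Rightarrow!\varphi\},\{\varphi\Rightarrow\psi\}],\varnothing,\psi\rangle$; $\langle[\{\Rightarrow!\varphi\},\{\Rightarrow\psi\}],\varnothing,\psi\rangle$; $\langle[\{\Rightarrow!\varphi\},\{!\varphi,!\varphi\Rightarrow\psi\}],\varnothing,\psi\rangle$. $\Gamma\vdash^*\varphi$ is the smallest relation closed under: (Ref) $\varphi\vdash^*\varphi$; (App) if $\langle\mathbf{A},\mathbf{S},\varphi\rangle$ is an instance of a schema in $\mathfrak{N}$ with $\mathbf{A}=\{\mathbf{T}_1,\dots,\mathbf{T}_m\}$, and there are $n\ge m$, multisets of formulae $\Gamma_1,\dots,\Gamma_n$ and formulae $\delta_{m+1},\dots,\delta_n$, with $!\Delta=\{!\delta_{m+1},\dots,!\delta_n\}$, such that $\Gamma_i\uplus\Psi\vdash^*\psi$ for every $i\le m$ and $\Psi\Rightarrow\psi\in\mathbf{T}_i$, $\Gamma_j\vdash^*\,!\delta_j$ for every $m<j\le n$, and $!\Delta\uplus\Theta\vdash^*\theta$ for every $\Theta\Rightarrow\theta\in\mathbf{S}$, then $\Gamma_1\uplus\dots\uplus\Gamma_n\vdash^*\varphi$. -}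

module Defs where

open import Data.Nat using (ℕ)
open import Data.List using (List; []; _∷_; _++_; [_]; map; concat)
open import Data.Product using (_×_; _,_; proj₁; proj₂)
open import Data.List.Relation.Unary.All using (All)
open import Data.List.Relation.Binary.Pointwise using (Pointwise)
open import Data.List.Relation.Binary.Permutation.Propositional using (_↭_)

infixr 6 _⊸_
infixr 7 _⊗_ _&_ _⊕_
infix 8 !_

data Formula : Set where
  atom : ℕ → Formula
  ⊤ᶠ   : Formula
  𝟘    : Formula
  𝟙    : Formula
  _⊸_  : Formula → Formula → Formula
  _⊗_  : Formula → Formula → Formula
  _&_  : Formula → Formula → Formula
  _⊕_  : Formula → Formula → Formula
  !_   : Formula → Formula

-- Finite multisets of formulae are represented by lists; every rule
-- concludes on any list that is a permutation (↭) of the multiset union,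
-- so both relations below are invariant under permutation, i.e. they are
-- relations on multisets.
Ctx : Set
Ctx = List Formula

bangs : List Formula → Ctx
bangs = map !_

infix 4 _⊢_

data _⊢_ : Ctx → Formula → Set where
  ax   : ∀ {φ} → [ φ ] ⊢ φ
  ⊸I   : ∀ {Γ φ ψ} → (φ ∷ Γ) ⊢ ψ → Γ ⊢ φ ⊸ ψ
  ⊸E   : ∀ {Γ Δ Σ φ ψ} → Γ ⊢ φ ⊸ ψ → Δ ⊢ φ → Σ ↭ Γ ++ Δ → Σ ⊢ ψ
  ⊗I   : ∀ {Γ Δ Σ φ ψ} → Γ ⊢ φ → Δ ⊢ ψ → Σ ↭ Γ ++ Δ → Σ ⊢ φ ⊗ ψ
  ⊗E   : ∀ {Γ Δ Σ φ ψ χ} → Γ ⊢ φ ⊗ ψ → (φ ∷ ψ ∷ Δ) ⊢ χ → Σ ↭ Γ ++ Δ → Σ ⊢ χ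
  𝟙I   : [] ⊢ 𝟙
  𝟙E   : ∀ {Γ Δ Σ φ} → Γ ⊢ 𝟙 → Δ ⊢ φ → Σ ↭ Γ ++ Δ → Σ ⊢ φ
  &I   : ∀ {Γ φ ψ} → Γ ⊢ φ → Γ ⊢ ψ → Γ ⊢ φ & ψ
  &E₁  : ∀ {Γ φ ψ} → Γ ⊢ φ & ψ → Γ ⊢ φ
  &E₂  : ∀ {Γ φ ψ} → Γ ⊢ φ & ψ → Γ ⊢ ψ
  ⊕I₁  : ∀ {Γ φ ψ} → Γ ⊢ φ → Γ ⊢ φ ⊕ ψ
  ⊕I₂  : ∀ {Γ φ ψ} → Γ ⊢ ψ → Γ ⊢ φ ⊕ ψ
  ⊕E   : ∀ {Γ Δ Σ φ ψ χ} → Γ ⊢ φ ⊕ ψ → (φ ∷ Δ) ⊢ χ → (ψ ∷ Δ) ⊢ χ →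
         Σ ↭ Γ ++ Δ → Σ ⊢ χ
  ⊤I   : ∀ {Σ} (ps : List (Ctx × Formula)) →
         All (λ p → proj₁ p ⊢ proj₂ p) ps →
         Σ ↭ concat (map proj₁ ps) → Σ ⊢ ⊤ᶠ
  𝟘E   : ∀ {Δ Σ χ} (ps : List (Ctx × Formula)) →
         All (λ p → proj₁ p ⊢ proj₂ p) ps → Δ ⊢ 𝟘 →
         Σ ↭ concat (map proj₁ ps) ++ Δ → Σ ⊢ χ
  prom : ∀ {Σ φ} (ps : List (Ctx × Formula)) →
         All (λ p → proj₁ p ⊢ ! proj₂ p) ps →
         bangs (map proj₂ ps) ⊢ φ →
         Σ ↭ concat (map proj₁ ps) → Σ ⊢ ! φ
  der  : ∀ {Γ Δ Σ φ ψ} → Γ ⊢ ! φ → (φ ∷ Δ) ⊢ ψ → Σ ↭ Γ ++ Δ → Σ ⊢ ψ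
  wk   : ∀ {Γ Δ Σ φ ψ} → Γ ⊢ ! φ → Δ ⊢ ψ → Σ ↭ Γ ++ Δ → Σ ⊢ ψ
  ctr  : ∀ {Γ Δ Σ φ ψ} → Γ ⊢ ! φ → (! φ ∷ ! φ ∷ Δ) ⊢ ψ → Σ ↭ Γ ++ Δ → Σ ⊢ ψ

infix 5.5 _⇒_

record Sequent : Set where
  constructor _⇒_
  field
    ante : Ctx
    succ : Formula
open Sequent public

Box : Set
Box = List Sequent

-- Inst A S φ : ⟨A , S , φ⟩ is an instance of a schema in 𝔑
-- (one constructor per schema; the schematic letters are the arguments).
data Inst : List Box → List Sequent → Formula → Set where
  i⊸I  : ∀ φ ψ → Inst (([ φ ] ⇒ ψ ∷ []) ∷ []) [] (φ ⊸ ψ)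
  i⊸E  : ∀ φ ψ → Inst (([] ⇒ φ ⊸ ψ ∷ []) ∷ ([] ⇒ φ ∷ []) ∷ []) [] ψ
  i⊗I  : ∀ φ ψ → Inst (([] ⇒ φ ∷ []) ∷ ([] ⇒ ψ ∷ []) ∷ []) [] (φ ⊗ ψ)
  i⊗E  : ∀ φ ψ χ → Inst (([] ⇒ φ ⊗ ψ ∷ []) ∷ ((φ ∷ ψ ∷ []) ⇒ χ ∷ []) ∷ []) [] χ
  i𝟙I  : Inst [] [] 𝟙
  i𝟙E  : ∀ χ → Inst (([] ⇒ 𝟙 ∷ []) ∷ ([] ⇒ χ ∷ []) ∷ []) [] χ
  i&I  : ∀ φ ψ → Inst (([] ⇒ φ ∷ [] ⇒ ψ ∷ []) ∷ []) [] (φ & ψ)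
  i&E₁ : ∀ φ ψ → Inst (([] ⇒ φ & ψ ∷ []) ∷ []) [] φ
  i&E₂ : ∀ φ ψ → Inst (([] ⇒ φ & ψ ∷ []) ∷ []) [] ψ
  i⊕I₁ : ∀ φ ψ → Inst (([] ⇒ φ ∷ []) ∷ []) [] (φ ⊕ ψ)
  i⊕I₂ : ∀ φ ψ → Inst (([] ⇒ ψ ∷ []) ∷ []) [] (φ ⊕ ψ)
  i⊕E  : ∀ φ ψ χ →
         Inst (([] ⇒ φ ⊕ ψ ∷ []) ∷ ([ φ ] ⇒ χ ∷ [ ψ ] ⇒ χ ∷ []) ∷ []) [] χ
  i⊤I  : ∀ (φs : List Formula) →
         Inst (map (λ φ → [] ⇒ φ ∷ []) φs) [] ⊤ᶠ
  i𝟘E  : ∀ (φs : List Formula) χ →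
         Inst (map (λ φ → [] ⇒ φ ∷ []) φs ++ ([] ⇒ 𝟘 ∷ []) ∷ []) [] χ
  iProm : ∀ φ → Inst [] ([] ⇒ φ ∷ []) (! φ)
  iDer : ∀ φ ψ → Inst (([] ⇒ ! φ ∷ []) ∷ ([ φ ] ⇒ ψ ∷ []) ∷ []) [] ψ
  iWk  : ∀ φ ψ → Inst (([] ⇒ ! φ ∷ []) ∷ ([] ⇒ ψ ∷ []) ∷ []) [] ψ
  iCtr : ∀ φ ψ →
         Inst (([] ⇒ ! φ ∷ []) ∷ ((! φ ∷ ! φ ∷ []) ⇒ ψ ∷ []) ∷ []) [] ψ

infix 4 _⊢*_

data _⊢*_ : Ctx → Formula → Set where
  ref : ∀ {φ} → [ φ ] ⊢* φ
  -- Γs = (Γ₁ … Γₘ), paired pointwise with the boxes T₁ … Tₘ;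
  -- ext = ((Γₘ₊₁ , δₘ₊₁) … (Γₙ , δₙ)), so n = m + length ext ≥ m;
  -- !Δ = bangs (map proj₂ ext).
  app : ∀ {A S φ Σ} → Inst A S φ →
        (Γs : List Ctx) →
        Pointwise (λ T Γ → All (λ s → Γ ++ ante s ⊢* succ s) T) A Γs →
        (ext : List (Ctx × Formula)) →
        All (λ p → proj₁ p ⊢* ! proj₂ p) ext →
        All (λ s → bangs (map proj₂ ext) ++ ante s ⊢* succ s) S →
        Σ ↭ concat Γs ++ concat (map proj₁ ext) →
        Σ ⊢* φ

{-# OPTIONS --safe #-}
-- Every rule of ⊢ is an instance of a schema of 𝔑 applied with no extra
-- !-premises (n = m), except promotion: its premises Γᵢ ⊢ !ψᵢ become the extra
-- premises and its subderivation !ψ₁ … !ψₙ ⊢ φ the stored sequent.  Conversely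
-- ⊢ is closed under (App): the boxes yield the premises of the matching rule,
-- and the extra premises Γⱼ ⊢ !δⱼ, which only promotion uses, are discarded by
-- weakening.  As ⊢* is the least relation closed under (Ref) and (App), it is
-- contained in ⊢.
module Submission where

open import Defs
open import Function.Bundles using (_⇔_; mk⇔)
open import Data.List using (List; []; _∷_; _++_; [_]; map; concat)
open import Data.List.Properties using (++-identityʳ; concat-++; concat-[_])
open import Data.Product using (_×_; _,_; proj₁; proj₂; ∃; ∃₂)
open import Data.List.Relation.Unary.All using (All; []; _∷_)
open import Data.List.Relation.Binary.Pointwise using (Pointwise; []; _∷_; ++⁺)
open import Data.List.Relation.Binary.Permutation.Propositional
  using (_↭_; ↭-refl; ↭-sym; ↭-trans; ↭-reflexive; prep)
open import Data.List.Relation.Binary.Permutation.Propositional.Properties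
  using (↭-singleton-inv; ↭-empty-inv; shifts; ++-comm)
open import Relation.Binary.PropositionalEquality using (_≡_; refl; sym; trans; cong; subst)

private
  variable
    A : List Box
    T : Box
    Γ Δ Σ : Ctx
    Γs : List Ctx
    φ : Formula

⊢-resp-↭ : Γ ↭ Δ → Γ ⊢ φ → Δ ⊢ φ
⊢-resp-↭ q ax rewrite ↭-singleton-inv (↭-sym q) = ax
⊢-resp-↭ q 𝟙I rewrite ↭-empty-inv (↭-sym q) = 𝟙I
⊢-resp-↭ q (⊸I d) = ⊸I (⊢-resp-↭ (prep _ q) d)
⊢-resp-↭ q (&I d e) = &I (⊢-resp-↭ q d) (⊢-resp-↭ q e)
⊢-resp-↭ q (&E₁ d) = &E₁ (⊢-resp-↭ q d)
⊢-resp-↭ q (&E₂ d) = &E₂ (⊢-resp-↭ q d)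
⊢-resp-↭ q (⊕I₁ d) = ⊕I₁ (⊢-resp-↭ q d)
⊢-resp-↭ q (⊕I₂ d) = ⊕I₂ (⊢-resp-↭ q d)
⊢-resp-↭ q (⊸E d e p) = ⊸E d e (↭-trans (↭-sym q) p)
⊢-resp-↭ q (⊗I d e p) = ⊗I d e (↭-trans (↭-sym q) p)
⊢-resp-↭ q (⊗E d e p) = ⊗E d e (↭-trans (↭-sym q) p)
⊢-resp-↭ q (𝟙E d e p) = 𝟙E d e (↭-trans (↭-sym q) p)
⊢-resp-↭ q (⊕E d e f p) = ⊕E d e f (↭-trans (↭-sym q) p)
⊢-resp-↭ q (⊤I ps ds p) = ⊤I ps ds (↭-trans (↭-sym q) p)
⊢-resp-↭ q (𝟘E ps ds d p) = 𝟘E ps ds d (↭-trans (↭-sym q) p)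
⊢-resp-↭ q (prom ps ds d p) = prom ps ds d (↭-trans (↭-sym q) p)
⊢-resp-↭ q (der d e p) = der d e (↭-trans (↭-sym q) p)
⊢-resp-↭ q (wk d e p) = wk d e (↭-trans (↭-sym q) p)
⊢-resp-↭ q (ctr d e p) = ctr d e (↭-trans (↭-sym q) p)

⊢*-resp-↭ : Γ ↭ Δ → Γ ⊢* φ → Δ ⊢* φ
⊢*-resp-↭ q ref rewrite ↭-singleton-inv (↭-sym q) = ref
⊢*-resp-↭ q (app i Γs bs ext es ss p) = app i Γs bs ext es ss (↭-trans (↭-sym q) p)

⊢-++-comm : ∀ Ψ → Γ ++ Ψ ⊢ φ → Ψ ++ Γ ⊢ φ
⊢-++-comm {Γ} Ψ = ⊢-resp-↭ (++-comm Γ Ψ)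

⊢*-++-comm : ∀ Ψ → Ψ ++ Γ ⊢* φ → Γ ++ Ψ ⊢* φ
⊢*-++-comm {Γ} Ψ = ⊢*-resp-↭ (++-comm Ψ Γ)

concat-pair : ∀ (Γ Δ : Ctx) → concat (Γ ∷ Δ ∷ []) ≡ Γ ++ Δ
concat-pair Γ Δ = cong (Γ ++_) (++-identityʳ Δ)

concat-∷ʳ : ∀ (Γs : List Ctx) Δ → concat (Γs ++ [ Δ ]) ≡ concat Γs ++ Δ
concat-∷ʳ Γs Δ = trans (sym (concat-++ Γs [ Δ ])) (cong (concat Γs ++_) concat-[ Δ ])

goal : Formula → Box
goal φ = [ [] ⇒ φ ]

BoxHolds : (Ctx → Formula → Set) → Box → Ctx → Set
BoxHolds R T Γ = All (λ s → R (Γ ++ ante s) (succ s)) T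

app-boxes : Inst A [] φ → ∀ Γs → Pointwise (BoxHolds _⊢*_) A Γs → Σ ↭ concat Γs → Σ ⊢* φ
app-boxes i Γs bs p =
  app i Γs bs [] [] [] (↭-trans p (↭-reflexive (sym (++-identityʳ (concat Γs)))))

app₁ : Inst [ T ] [] φ → BoxHolds _⊢*_ T Γ → Γ ⊢* φ
app₁ {Γ = Γ} i b = app-boxes i [ Γ ] (b ∷ []) (↭-reflexive (sym concat-[ Γ ]))

app₂ : ∀ {U} → Inst (T ∷ U ∷ []) [] φ →
       BoxHolds _⊢*_ T Γ → BoxHolds _⊢*_ U Δ → Σ ↭ Γ ++ Δ → Σ ⊢* φ
app₂ {Γ = Γ} {Δ = Δ} i b c p =
  app-boxes i (Γ ∷ Δ ∷ []) (b ∷ c ∷ []) (↭-trans p (↭-reflexive (sym (concat-pair Γ Δ))))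

pairs⇒goals : ∀ ps → All (λ p → proj₁ p ⊢* proj₂ p) ps →
              Pointwise (BoxHolds _⊢*_) (map goal (map proj₂ ps)) (map proj₁ ps)
pairs⇒goals [] [] = []
pairs⇒goals (_ ∷ ps) (d ∷ ds) = (⊢*-++-comm [] d ∷ []) ∷ pairs⇒goals ps ds

mutual
  ⊢⇒⊢* : Γ ⊢ φ → Γ ⊢* φ
  ⊢⇒⊢* ax = ref
  ⊢⇒⊢* 𝟙I = app-boxes i𝟙I [] [] ↭-refl
  ⊢⇒⊢* (⊸I {φ = φ} d) = app₁ (i⊸I φ _) (⊢⇒box [ φ ] d)
  ⊢⇒⊢* (&I d e) = app₁ (i&I _ _) (⊢*-++-comm [] (⊢⇒⊢* d) ∷ ⊢*-++-comm [] (⊢⇒⊢* e) ∷ [])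
  ⊢⇒⊢* (&E₁ d) = app₁ (i&E₁ _ _) (⊢⇒box [] d)
  ⊢⇒⊢* (&E₂ d) = app₁ (i&E₂ _ _) (⊢⇒box [] d)
  ⊢⇒⊢* (⊕I₁ d) = app₁ (i⊕I₁ _ _) (⊢⇒box [] d)
  ⊢⇒⊢* (⊕I₂ d) = app₁ (i⊕I₂ _ _) (⊢⇒box [] d)
  ⊢⇒⊢* (⊸E d e p) = app₂ (i⊸E _ _) (⊢⇒box [] d) (⊢⇒box [] e) p
  ⊢⇒⊢* (⊗I d e p) = app₂ (i⊗I _ _) (⊢⇒box [] d) (⊢⇒box [] e) p
  ⊢⇒⊢* (⊗E {φ = φ} {ψ} d e p) = app₂ (i⊗E φ ψ _) (⊢⇒box [] d) (⊢⇒box (φ ∷ ψ ∷ []) e) p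
  ⊢⇒⊢* (𝟙E d e p) = app₂ (i𝟙E _) (⊢⇒box [] d) (⊢⇒box [] e) p
  ⊢⇒⊢* (⊕E {φ = φ} {ψ} d e f p) =
    app₂ (i⊕E φ ψ _) (⊢⇒box [] d)
      (⊢*-++-comm [ φ ] (⊢⇒⊢* e) ∷ ⊢*-++-comm [ ψ ] (⊢⇒⊢* f) ∷ []) p
  ⊢⇒⊢* (der {φ = φ} d e p) = app₂ (iDer φ _) (⊢⇒box [] d) (⊢⇒box [ φ ] e) p
  ⊢⇒⊢* (wk d e p) = app₂ (iWk _ _) (⊢⇒box [] d) (⊢⇒box [] e) p
  ⊢⇒⊢* (ctr {φ = φ} d e p) = app₂ (iCtr φ _) (⊢⇒box [] d) (⊢⇒box (! φ ∷ ! φ ∷ []) e) p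
  ⊢⇒⊢* (⊤I ps ds p) = app-boxes (i⊤I _) (map proj₁ ps) (pairs⇒goals ps (All-⊢⇒⊢* ds)) p
  ⊢⇒⊢* (𝟘E {Δ} ps ds d p) =
    app-boxes (i𝟘E _ _) (map proj₁ ps ++ [ Δ ])
      (++⁺ (pairs⇒goals ps (All-⊢⇒⊢* ds)) (⊢⇒box [] d ∷ []))
      (↭-trans p (↭-reflexive (sym (concat-∷ʳ (map proj₁ ps) Δ))))
  ⊢⇒⊢* (prom ps ds d p) = app (iProm _) [] [] ps (All-⊢⇒⊢* ds) (⊢⇒box [] d) p

  ⊢⇒box : ∀ Ψ → Ψ ++ Γ ⊢ φ → BoxHolds _⊢*_ [ Ψ ⇒ φ ] Γ
  ⊢⇒box Ψ d = ⊢*-++-comm Ψ (⊢⇒⊢* d) ∷ []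

  All-⊢⇒⊢* : ∀ {f : Ctx × Formula → Formula} {ps} →
             All (λ p → proj₁ p ⊢ f p) ps → All (λ p → proj₁ p ⊢* f p) ps
  All-⊢⇒⊢* [] = []
  All-⊢⇒⊢* (d ∷ ds) = ⊢⇒⊢* d ∷ All-⊢⇒⊢* ds

AppClosed : (Ctx → Formula → Set) → Set
AppClosed R = ∀ {A S φ Σ} → Inst A S φ →
  (Γs : List Ctx) → Pointwise (BoxHolds R) A Γs →
  (ext : List (Ctx × Formula)) → All (λ p → R (proj₁ p) (! proj₂ p)) ext →
  All (λ s → R (bangs (map proj₂ ext) ++ ante s) (succ s)) S →
  Σ ↭ concat Γs ++ concat (map proj₁ ext) → R Σ φ

module _ {R : Ctx → Formula → Set}
         (R-ref : ∀ {φ} → R [ φ ] φ) (R-app : AppClosed R) where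

  mutual
    ⊢*-least : Γ ⊢* φ → R Γ φ
    ⊢*-least ref = R-ref
    ⊢*-least (app i Γs bs ext es ss p) =
      R-app i Γs (boxes-least bs) ext (bangs-least es) (box-least ss) p

    box-least : BoxHolds _⊢*_ T Γ → BoxHolds R T Γ
    box-least [] = []
    box-least (d ∷ ds) = ⊢*-least d ∷ box-least ds

    boxes-least : Pointwise (BoxHolds _⊢*_) A Γs → Pointwise (BoxHolds R) A Γs
    boxes-least [] = []
    boxes-least (b ∷ bs) = box-least b ∷ boxes-least bs

    bangs-least : ∀ {ext} → All (λ p → proj₁ p ⊢* ! proj₂ p) ext →
                  All (λ p → R (proj₁ p) (! proj₂ p)) ext
    bangs-least [] = []
    bangs-least (d ∷ ds) = ⊢*-least d ∷ bangs-least ds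

Pointwise-++⁻ : ∀ {R : Box → Ctx → Set} As {Bs Γs} → Pointwise R (As ++ Bs) Γs →
                ∃₂ λ Γs₁ Γs₂ → Pointwise R As Γs₁ × Pointwise R Bs Γs₂ × Γs ≡ Γs₁ ++ Γs₂
Pointwise-++⁻ [] rs = [] , _ , [] , rs , refl
Pointwise-++⁻ (_ ∷ As) (r ∷ rs) with Γs₁ , Γs₂ , rs₁ , rs₂ , refl ← Pointwise-++⁻ As rs =
  _ ∷ Γs₁ , Γs₂ , r ∷ rs₁ , rs₂ , refl

goals⇒pairs : ∀ φs → Pointwise (BoxHolds _⊢_) (map goal φs) Γs →
              ∃ λ ps → All (λ p → proj₁ p ⊢ proj₂ p) ps × map proj₁ ps ≡ Γs
goals⇒pairs [] [] = [] , [] , refl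
goals⇒pairs (φ ∷ φs) ((d ∷ []) ∷ bs) with ps , ds , refl ← goals⇒pairs φs bs =
  (_ , φ) ∷ ps , ⊢-++-comm [] d ∷ ds , refl

⊢-concat-[-] : Γ ⊢ φ → concat [ Γ ] ⊢ φ
⊢-concat-[-] {Γ} = subst (_⊢ _) (sym concat-[ Γ ])

⊢-inst : Inst A [] φ → ∀ Γs → Pointwise (BoxHolds _⊢_) A Γs → concat Γs ⊢ φ
⊢-inst (i⊸I φ _) (Γ ∷ []) ((d ∷ []) ∷ []) =
  ⊢-concat-[-] (⊸I (⊢-++-comm [ φ ] d))
⊢-inst (i⊸E _ _) (Γ ∷ Δ ∷ []) ((d ∷ []) ∷ (e ∷ []) ∷ []) =
  ⊸E (⊢-++-comm [] d) (⊢-++-comm [] e) (↭-reflexive (concat-pair Γ Δ))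
⊢-inst (i⊗I _ _) (Γ ∷ Δ ∷ []) ((d ∷ []) ∷ (e ∷ []) ∷ []) =
  ⊗I (⊢-++-comm [] d) (⊢-++-comm [] e) (↭-reflexive (concat-pair Γ Δ))
⊢-inst (i⊗E φ ψ _) (Γ ∷ Δ ∷ []) ((d ∷ []) ∷ (e ∷ []) ∷ []) =
  ⊗E (⊢-++-comm [] d) (⊢-++-comm (φ ∷ ψ ∷ []) e) (↭-reflexive (concat-pair Γ Δ))
⊢-inst i𝟙I [] [] = 𝟙I
⊢-inst (i𝟙E _) (Γ ∷ Δ ∷ []) ((d ∷ []) ∷ (e ∷ []) ∷ []) =
  𝟙E (⊢-++-comm [] d) (⊢-++-comm [] e) (↭-reflexive (concat-pair Γ Δ))
⊢-inst (i&I _ _) (Γ ∷ []) ((d ∷ e ∷ []) ∷ []) =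
  ⊢-concat-[-] (&I (⊢-++-comm [] d) (⊢-++-comm [] e))
⊢-inst (i&E₁ _ _) (Γ ∷ []) ((d ∷ []) ∷ []) =
  ⊢-concat-[-] (&E₁ (⊢-++-comm [] d))
⊢-inst (i&E₂ _ _) (Γ ∷ []) ((d ∷ []) ∷ []) =
  ⊢-concat-[-] (&E₂ (⊢-++-comm [] d))
⊢-inst (i⊕I₁ _ _) (Γ ∷ []) ((d ∷ []) ∷ []) =
  ⊢-concat-[-] (⊕I₁ (⊢-++-comm [] d))
⊢-inst (i⊕I₂ _ _) (Γ ∷ []) ((d ∷ []) ∷ []) =
  ⊢-concat-[-] (⊕I₂ (⊢-++-comm [] d))
⊢-inst (i⊕E φ ψ _) (Γ ∷ Δ ∷ []) ((d ∷ []) ∷ (e ∷ f ∷ []) ∷ []) =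
  ⊕E (⊢-++-comm [] d) (⊢-++-comm [ φ ] e) (⊢-++-comm [ ψ ] f)
     (↭-reflexive (concat-pair Γ Δ))
⊢-inst (i⊤I φs) Γs bs with ps , ds , refl ← goals⇒pairs φs bs =
  ⊤I ps ds ↭-refl
⊢-inst (i𝟘E φs _) Γs bs
  with Γs₁ , Δ ∷ [] , bs₁ , (d ∷ []) ∷ [] , refl ← Pointwise-++⁻ (map goal φs) bs
  with ps , ds , refl ← goals⇒pairs φs bs₁ =
  𝟘E ps ds (⊢-++-comm [] d) (↭-reflexive (concat-∷ʳ (map proj₁ ps) Δ))
⊢-inst (iDer φ _) (Γ ∷ Δ ∷ []) ((d ∷ []) ∷ (e ∷ []) ∷ []) =
  der (⊢-++-comm [] d) (⊢-++-comm [ φ ] e) (↭-reflexive (concat-pair Γ Δ))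
⊢-inst (iWk _ _) (Γ ∷ Δ ∷ []) ((d ∷ []) ∷ (e ∷ []) ∷ []) =
  wk (⊢-++-comm [] d) (⊢-++-comm [] e) (↭-reflexive (concat-pair Γ Δ))
⊢-inst (iCtr φ _) (Γ ∷ Δ ∷ []) ((d ∷ []) ∷ (e ∷ []) ∷ []) =
  ctr (⊢-++-comm [] d) (⊢-++-comm (! φ ∷ ! φ ∷ []) e) (↭-reflexive (concat-pair Γ Δ))

⊢-weaken-! : ∀ ext → All (λ p → proj₁ p ⊢ ! proj₂ p) ext →
             Γ ⊢ φ → Σ ↭ Γ ++ concat (map proj₁ ext) → Σ ⊢ φ
⊢-weaken-! {Γ} [] [] d p = ⊢-resp-↭ (↭-sym (↭-trans p (↭-reflexive (++-identityʳ Γ)))) d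
⊢-weaken-! {Γ} ((Θ , _) ∷ ext) (e ∷ es) d p =
  wk e (⊢-weaken-! ext es d ↭-refl) (↭-trans p (shifts Γ Θ))

⊢-app : AppClosed _⊢_
⊢-app (iProm _) [] [] ext es (d ∷ []) p = prom ext es (⊢-++-comm [] d) p
⊢-app i Γs bs ext es [] p = ⊢-weaken-! ext es (⊢-inst i Γs bs) p

⊢*⇒⊢ : Γ ⊢* φ → Γ ⊢ φ
⊢*⇒⊢ = ⊢*-least ax ⊢-app

mainTheorem3 : ∀ (Γ : Ctx) (φ : Formula) → (Γ ⊢ φ) ⇔ (Γ ⊢* φ)
mainTheorem3 Γ φ = mk⇔ ⊢⇒⊢* ⊢*⇒⊢
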